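{- Suppose the sequent $\Gamma,A_1\wedge A_2$ is minimal. Let $\Gamma_1$ and $\Gamma_2$ each be obtained from $\Gamma$ by deleting zero or more formulas, chosen so that $\Gamma_1,A_1$ and $\Gamma_2,A_2$ are both minimal. Then every formula (occurrence) of $\Gamma$ lies in at least one of $\Gamma_1,\Gamma_2$.
   Context: Formulas are built from literals, namely propositional variables $P$ and their complements $\bar P$, using $\wedge$ and $\vee$. A sequent is a nonempty finite multiset of formulas, and a comma denotes multiset union. A sequent $A_1,\dots,A_n$ is valid if $A_1\vee\cdots\vee A_n$ evaluates to $1$ under every $0/1$-assignment, with $\bar P$ read as the complement of $P$. A subsequent is obtained by deleting zero or more formulas, and it is proper if at least one formula is deleted. A sequent is minimal if it is valid and no proper subsequent of it is valid. -}

module Defs where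

open import Data.Nat using (ℕ)
open import Data.Bool using (Bool; true; false; not; _∧_; _∨_)
open import Data.List using (List; []; _∷_; length; _++_; [_])
open import Data.Vec using (Vec; []; _∷_; lookup)
open import Data.Fin using (Fin)
open import Data.Product using (∃; _×_)
open import Relation.Nullary using (¬_)
open import Relation.Binary.PropositionalEquality using (_≡_)

data Formula : Set where
  pos  : ℕ → Formula
  neg  : ℕ → Formula
  _∧ᶠ_ : Formula → Formula → Formula
  _∨ᶠ_ : Formula → Formula → Formula

Assignment : Set
Assignment = ℕ → Bool

eval : Assignment → Formula → Bool
eval ρ (pos p)  = ρ p
eval ρ (neg p)  = not (ρ p)
eval ρ (A ∧ᶠ B) = eval ρ A ∧ eval ρ B
eval ρ (A ∨ᶠ B) = eval ρ A ∨ eval ρ B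

-- A sequent is a finite multiset of formulas, represented as a list
-- (comma = concatenation; validity is order-independent).
Sequent : Set
Sequent = List Formula

evalSeq : Assignment → Sequent → Bool
evalSeq ρ []      = false
evalSeq ρ (A ∷ Γ) = eval ρ A ∨ evalSeq ρ Γ

Valid : Sequent → Set
Valid Γ = (ρ : Assignment) → evalSeq ρ Γ ≡ true

-- A deletion pattern: for every occurrence, true = kept, false = deleted.
Mask : Sequent → Set
Mask Γ = Vec Bool (length Γ)

select : (Γ : Sequent) → Mask Γ → Sequent
select []      []          = []
select (A ∷ Γ) (true ∷ m)  = A ∷ select Γ m
select (A ∷ Γ) (false ∷ m) = select Γ m

Proper : (Γ : Sequent) → Mask Γ → Set
Proper Γ m = ∃ λ (i : Fin (length Γ)) → lookup m i ≡ false

Minimal : Sequent → Set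
Minimal Γ = Valid Γ × ((m : Mask Γ) → Proper Γ m → ¬ Valid (select Γ m))

{-# OPTIONS --safe #-}
-- If the i-th formula of Γ were deleted in both Γ₁ and Γ₂, then Γ₁ and Γ₂ would
-- both be subsequents of Γ with its i-th formula deleted, call it Γ∖i. Validity
-- of Γ₁,A₁ and Γ₂,A₂ then makes Γ∖i,A₁∧A₂ valid (∧-introduction after weakening),
-- a proper subsequent of the minimal sequent Γ,A₁∧A₂.
module Submission where

open import Defs
open import Data.Bool using (Bool; true; false; _∧_; _∨_; _≤_; b≤b; f≤t)
open import Data.Bool.Properties using (≤-refl; ≤-trans; ≤-maximum; ∨-assoc; ∨-identityʳ)
open import Data.List using ([]; _∷_; length; _++_; [_])
open import Data.Vec using (Vec; []; _∷_; lookup; replicate; _[_]≔_)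
open import Data.Vec.Properties using ([]≔-lookup; lookup∘update)
open import Data.Vec.Relation.Binary.Pointwise.Inductive using (Pointwise; []; _∷_; cong-[_]≔)
open import Data.Fin using (Fin; zero; suc)
open import Data.Sum using (_⊎_; inj₁; inj₂)
open import Data.Product using (_,_)
open import Data.Empty using (⊥-elim)
open import Relation.Binary.PropositionalEquality using (_≡_; refl; sym; trans; cong; subst; subst₂)

∨-monoʳ-≤ : ∀ b {x y} → x ≤ y → b ∨ x ≤ b ∨ y
∨-monoʳ-≤ true  _   = b≤b
∨-monoʳ-≤ false x≤y = x≤y

y≤x∨y : ∀ x y → y ≤ x ∨ y
y≤x∨y true  y = ≤-maximum y
y≤x∨y false y = ≤-refl

∨-∧-intro : ∀ {e₁ e₂ e a₁ a₂} → e₁ ≤ e → e₂ ≤ e →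
            e₁ ∨ a₁ ≡ true → e₂ ∨ a₂ ≡ true → e ∨ (a₁ ∧ a₂) ≡ true
∨-∧-intro {e = true}  _   _   _    _    = refl
∨-∧-intro {e = false} b≤b b≤b refl refl = refl

evalSeq-∷ʳ : ∀ ρ Δ A → evalSeq ρ (Δ ++ [ A ]) ≡ evalSeq ρ Δ ∨ eval ρ A
evalSeq-∷ʳ ρ []      A = ∨-identityʳ (eval ρ A)
evalSeq-∷ʳ ρ (B ∷ Δ) A =
  trans (cong (eval ρ B ∨_) (evalSeq-∷ʳ ρ Δ A)) (sym (∨-assoc (eval ρ B) _ _))

evalSeq-select-mono : ∀ ρ Γ {m m′ : Mask Γ} → Pointwise _≤_ m m′ →
                      evalSeq ρ (select Γ m) ≤ evalSeq ρ (select Γ m′)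
evalSeq-select-mono ρ []      []                         = b≤b
evalSeq-select-mono ρ (B ∷ Γ) {true  ∷ _} (b≤b ∷ m≤m′) =
  ∨-monoʳ-≤ (eval ρ B) (evalSeq-select-mono ρ Γ m≤m′)
evalSeq-select-mono ρ (B ∷ Γ) {false ∷ _} (b≤b ∷ m≤m′) = evalSeq-select-mono ρ Γ m≤m′
evalSeq-select-mono ρ (B ∷ Γ)             (f≤t ∷ m≤m′) =
  ≤-trans (evalSeq-select-mono ρ Γ m≤m′) (y≤x∨y (eval ρ B) _)

≤-allTrue : ∀ {n} (m : Vec Bool n) → Pointwise _≤_ m (replicate n true)
≤-allTrue []      = []
≤-allTrue (b ∷ m) = ≤-maximum b ∷ ≤-allTrue m

keepAllBut : (Γ : Sequent) → Fin (length Γ) → Mask Γ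
keepAllBut Γ i = replicate (length Γ) true [ i ]≔ false

keepAllBut-proper : ∀ Γ i → Proper Γ (keepAllBut Γ i)
keepAllBut-proper Γ i = i , lookup∘update i (replicate (length Γ) true) false

≤-keepAllBut : ∀ Γ (m : Mask Γ) i → lookup m i ≡ false → Pointwise _≤_ m (keepAllBut Γ i)
≤-keepAllBut Γ m i mᵢ≡false =
  subst₂ (Pointwise _≤_) ([]≔-lookup m i) (cong (replicate (length Γ) true [ i ]≔_) mᵢ≡false)
         (cong-[_]≔ ≤-refl i (lookup m i) (≤-allTrue m))

appendMask : ∀ Γ Δ → Mask Γ → Mask Δ → Mask (Γ ++ Δ)
appendMask []      Δ []      n = n
appendMask (_ ∷ Γ) Δ (b ∷ m) n = b ∷ appendMask Γ Δ m n

select-appendMask : ∀ Γ Δ (m : Mask Γ) (n : Mask Δ) →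
                    select (Γ ++ Δ) (appendMask Γ Δ m n) ≡ select Γ m ++ select Δ n
select-appendMask []      Δ []          n = refl
select-appendMask (B ∷ Γ) Δ (true  ∷ m) n = cong (B ∷_) (select-appendMask Γ Δ m n)
select-appendMask (B ∷ Γ) Δ (false ∷ m) n = select-appendMask Γ Δ m n

proper-appendMask : ∀ Γ Δ {m : Mask Γ} {n : Mask Δ} → Proper Γ m → Proper (Γ ++ Δ) (appendMask Γ Δ m n)
proper-appendMask (B ∷ Γ) Δ {_ ∷ _} (zero  , mᵢ≡false) = zero , mᵢ≡false
proper-appendMask (B ∷ Γ) Δ {_ ∷ _} (suc i , mᵢ≡false) with proper-appendMask Γ Δ (i , mᵢ≡false)
... | j , m++nⱼ≡false = suc j , m++nⱼ≡false

∧-valid : ∀ Γ {A₁ A₂} {m₁ m₂ m : Mask Γ} → Pointwise _≤_ m₁ m → Pointwise _≤_ m₂ m →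
          Valid (select Γ m₁ ++ [ A₁ ]) → Valid (select Γ m₂ ++ [ A₂ ]) →
          Valid (select Γ m ++ [ A₁ ∧ᶠ A₂ ])
∧-valid Γ {A₁} {A₂} {m₁} {m₂} {m} m₁≤m m₂≤m valid₁ valid₂ ρ =
  trans (evalSeq-∷ʳ ρ (select Γ m) (A₁ ∧ᶠ A₂))
        (∨-∧-intro (evalSeq-select-mono ρ Γ m₁≤m) (evalSeq-select-mono ρ Γ m₂≤m)
                   (trans (sym (evalSeq-∷ʳ ρ (select Γ m₁) A₁)) (valid₁ ρ))
                   (trans (sym (evalSeq-∷ʳ ρ (select Γ m₂) A₂)) (valid₂ ρ)))

lemma4 : (Γ : Sequent) (A₁ A₂ : Formula) (m₁ m₂ : Mask Γ)
         → Minimal (Γ ++ [ A₁ ∧ᶠ A₂ ])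
         → Minimal (select Γ m₁ ++ [ A₁ ])
         → Minimal (select Γ m₂ ++ [ A₂ ])
         → (i : Fin (length Γ)) → lookup m₁ i ≡ true ⊎ lookup m₂ i ≡ true
lemma4 Γ A₁ A₂ m₁ m₂ (_ , minimal) (valid₁ , _) (valid₂ , _) i
  with lookup m₁ i in m₁ᵢ | lookup m₂ i in m₂ᵢ
... | true  | _     = inj₁ refl
... | false | true  = inj₂ refl
... | false | false = ⊥-elim (minimal Γ∖i,A proper valid)
  where
    Γ∖i,A : Mask (Γ ++ [ A₁ ∧ᶠ A₂ ])
    Γ∖i,A = appendMask Γ [ A₁ ∧ᶠ A₂ ] (keepAllBut Γ i) (true ∷ [])

    proper : Proper (Γ ++ [ A₁ ∧ᶠ A₂ ]) Γ∖i,A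
    proper = proper-appendMask Γ [ A₁ ∧ᶠ A₂ ] (keepAllBut-proper Γ i)

    valid : Valid (select (Γ ++ [ A₁ ∧ᶠ A₂ ]) Γ∖i,A)
    valid = subst Valid (sym (select-appendMask Γ [ A₁ ∧ᶠ A₂ ] (keepAllBut Γ i) (true ∷ [])))
                  (∧-valid Γ (≤-keepAllBut Γ m₁ i m₁ᵢ) (≤-keepAllBut Γ m₂ i m₂ᵢ) valid₁ valid₂)
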